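{- Let $n\ge 1$ and let the two colors of $C_2$ be $a$ and $b$. There is a bijection between $\Pi_n^{eq}\wr C_2(1^a2^a)$ and the set of set partitions of $[n+3]$ which have at least one singleton block and in which the largest element forming a singleton block is $n+1$.
   Context: $\Pi_n\wr C_2$ denotes the set of colored set partitions of $[n]$: pairs consisting of a set partition of $[n]$ and an assignment of one of two colors $a,b$ to each element. A colored partition eq-contains $1^a2^a$ if there are elements $x<y$ in different blocks both colored $a$; $\Pi_n^{eq}\wr C_2(1^a2^a)$ is the set of colored partitions that do not (i.e. all $a$-colored elements lie in a single block). -}

module Defs where

open import Data.Nat using (ℕ; _+_; _<_; _≤_)
open import Data.Bool using (Bool; true; false)
open import Data.Fin using (Fin; toℕ)
open import Data.Vec using (Vec; lookup)
open import Relation.Binary.PropositionalEquality using (_≡_)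
open import Relation.Nullary using (¬_)
open import Data.Product using (Σ; _×_)

-- Elements of [n] = {1,…,n} are represented by Fin n (element k ↔ index k-1).
-- A set partition of [n] is given by its equivalence relation "x and y lie in
-- the same block", stored as a finite Boolean table (so that equality of
-- partitions is equality of tables).
record SetPartition (n : ℕ) : Set where
  constructor mkPartition
  field
    table : Vec (Vec Bool n) n
  sameBlock : Fin n → Fin n → Set
  sameBlock i j = lookup (lookup table i) j ≡ true
  field
    .reflexive  : ∀ i → sameBlock i i
    .symmetric  : ∀ i j → sameBlock i j → sameBlock j i
    .transitive : ∀ i j k → sameBlock i j → sameBlock j k → sameBlock i k

open SetPartition public

IsSingleton : ∀ {n} → SetPartition n → Fin n → Set
IsSingleton P i = ∀ j → sameBlock P i j → j ≡ i

data Colour : Set where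
  a b : Colour

record ColouredPartition (n : ℕ) : Set where
  constructor mkColoured
  field
    partition : SetPartition n
    colour    : Vec Colour n

open ColouredPartition public

EqContains1a2a : ∀ {n} → ColouredPartition n → Set
EqContains1a2a {n} C =
  Σ (Fin n) λ x → Σ (Fin n) λ y →
    (toℕ x < toℕ y) × ¬ sameBlock (partition C) x y
      × (lookup (colour C) x ≡ a) × (lookup (colour C) y ≡ a)

record AvoidingColoured (n : ℕ) : Set where
  constructor mkAvoiding
  field
    coloured : ColouredPartition n
    .avoids  : ¬ EqContains1a2a coloured

record LargestSingletonPartition (n : ℕ) : Set where
  constructor mkLSP
  field
    part : SetPartition (n + 3)
    .hasSingleton : Σ (Fin (n + 3)) λ i → IsSingleton part i × toℕ i ≡ n
    .largest      : ∀ j → IsSingleton part j → toℕ j ≤ n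

-- Theorem 3.1.  Coloured partitions of [n] whose a-coloured elements all lie in
-- one block are in bijection with partitions of [n+3] whose largest singleton
-- is n+1.  (The argument does not use the hypothesis 1 ≤ n.)
--
-- Write ν₁, ν₂, ν₃ for n+1, n+2, n+3, and call the block containing the
-- a-coloured elements the a-block.  Forward: keep all other blocks, put the
-- a-coloured elements together with ν₂, the b-coloured part of the a-block
-- together with ν₃ (ν₃ joins ν₂ when that part is empty), and leave ν₁ alone.
-- Backward: colour x with a iff x shares the block of ν₂, merge the blocks of
-- ν₂ and ν₃, and forget the new elements.
--
-- Partitions are handled through their Boolean "same block" relations, and
-- both maps are pullbacks of an equivalence along a relabelling of the points,
-- so that no transitivity has to be checked by hand.
module Submission where

open import Defs
open import Data.Nat using (ℕ; zero; suc; _+_; _≤_)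
open import Data.Nat.Properties using (<-cmp; <⇒≤; ≤-refl; m+1+n≰m; +-identityʳ)
open import Data.Bool using (Bool; true; false; _∧_; _∨_; not; if_then_else_)
open import Data.Bool.Properties using (⇔→≡; ∨-zeroʳ; ∨-conicalˡ; ∨-conicalʳ; ∧-conicalˡ; ∧-conicalʳ) renaming (_≟_ to _≟ᵇ_)
open import Data.Fin using (Fin; zero; suc; toℕ; splitAt; join)
open import Data.Fin.Properties using (toℕ<n; toℕ-injective; toℕ-↑ˡ; toℕ-↑ʳ; splitAt-join; join-splitAt)
  renaming (_≟_ to _≟ᶠ_)
open import Data.Vec using (Vec; lookup; tabulate)
open import Data.Vec.Properties using (lookup∘tabulate; tabulate∘lookup; tabulate-cong)
open import Data.Sum using (_⊎_; inj₁; inj₂)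
open import Data.Sum.Properties using (≡-dec)
open import Data.Product using (Σ; _×_; _,_; proj₁; proj₂)
open import Data.Empty using (⊥-elim; ⊥-elim-irr)
open import Relation.Nullary using (¬_; does; yes)
open import Relation.Nullary.Decidable using (dec-true; recompute)
open import Relation.Binary using (DecidableEquality; tri<; tri≈; tri>)
open import Relation.Binary.PropositionalEquality
open import Function.Bundles using (_⤖_; mk⇔; mk↔ₛ′)
open import Function.Properties.Inverse using (↔⇒⤖)

record IsEquivalenceᵇ {X : Set} (_∼_ : X → X → Bool) : Set where
  field
    ∼-refl  : ∀ x → (x ∼ x) ≡ true
    ∼-sym   : ∀ x y → (x ∼ y) ≡ true → (y ∼ x) ≡ true
    ∼-trans : ∀ x y z → (x ∼ y) ≡ true → (y ∼ z) ≡ true → (x ∼ z) ≡ true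

open IsEquivalenceᵇ

false≢true : ¬ (false ≡ true)
false≢true ()

not-true : ∀ {p} → not p ≡ true → p ≡ false
not-true {false} _ = refl

bool-ext : {p q : Bool} → (p ≡ true → q ≡ true) → (q ≡ true → p ≡ true) → p ≡ q
bool-ext f g = ⇔→≡ (mk⇔ f g)

∼-comm : {X : Set} {E : X → X → Bool} → IsEquivalenceᵇ E → ∀ x y → E x y ≡ E y x
∼-comm e x y = bool-ext (∼-sym e x y) (∼-sym e y x)

pullback : {X Y : Set} {E : X → X → Bool} (f : Y → X) →
           IsEquivalenceᵇ E → IsEquivalenceᵇ (λ u v → E (f u) (f v))
pullback f e = record
  { ∼-refl  = λ u → ∼-refl e (f u)
  ; ∼-sym   = λ u v → ∼-sym e (f u) (f v)
  ; ∼-trans = λ u v w → ∼-trans e (f u) (f v) (f w)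
  }

pullback-of-representatives : {X : Set} {_∼_ E : X → X → Bool} → IsEquivalenceᵇ _∼_ → (f : X → X) →
  (∀ u → (u ∼ f u) ≡ true) → (∀ u v → E (f u) (f v) ≡ (f u ∼ f v)) → ∀ u v → E (f u) (f v) ≡ (u ∼ v)
pullback-of-representatives {_∼_ = _∼_} e f in-class agree u v = trans (agree u v) (bool-ext to from)
  where
  to : (f u ∼ f v) ≡ true → (u ∼ v) ≡ true
  to p = ∼-trans e u (f u) v (in-class u) (∼-trans e (f u) (f v) v p (∼-sym e v (f v) (in-class v)))
  from : (u ∼ v) ≡ true → (f u ∼ f v) ≡ true
  from p = ∼-trans e (f u) u (f v) (∼-sym e u (f u) (in-class u)) (∼-trans e u v (f v) p (in-class v))

discrete : {A : Set} → DecidableEquality A → A → A → Bool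
discrete _≟_ x y = does (x ≟ y)

discrete-sound : {A : Set} (_≟_ : DecidableEquality A) {x y : A} → discrete _≟_ x y ≡ true → x ≡ y
discrete-sound _≟_ {x} {y} p with x ≟ y
... | yes x≡y = x≡y

discrete-equiv : {A : Set} (_≟_ : DecidableEquality A) → IsEquivalenceᵇ (discrete _≟_)
discrete-equiv _≟_ = record
  { ∼-refl  = λ x → dec-true (x ≟ x) refl
  ; ∼-sym   = λ x y p → dec-true (y ≟ x) (sym (discrete-sound _≟_ p))
  ; ∼-trans = λ x y z p q → dec-true (x ≟ z) (trans (discrete-sound _≟_ p) (discrete-sound _≟_ q))
  }

_⊕_ : {A B : Set} → (A → A → Bool) → (B → B → Bool) → A ⊎ B → A ⊎ B → Bool
(E ⊕ F) (inj₁ x) (inj₁ y) = E x y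
(E ⊕ F) (inj₂ x) (inj₂ y) = F x y
(E ⊕ F) _        _        = false

⊕-equiv : {A B : Set} {E : A → A → Bool} {F : B → B → Bool} →
          IsEquivalenceᵇ E → IsEquivalenceᵇ F → IsEquivalenceᵇ (E ⊕ F)
⊕-equiv {E = E} {F} e f = record { ∼-refl = r ; ∼-sym = s ; ∼-trans = t }
  where
  r : ∀ u → (E ⊕ F) u u ≡ true
  r (inj₁ x) = ∼-refl e x
  r (inj₂ x) = ∼-refl f x
  s : ∀ u v → (E ⊕ F) u v ≡ true → (E ⊕ F) v u ≡ true
  s (inj₁ x) (inj₁ y) = ∼-sym e x y
  s (inj₂ x) (inj₂ y) = ∼-sym f x y
  t : ∀ u v w → (E ⊕ F) u v ≡ true → (E ⊕ F) v w ≡ true → (E ⊕ F) u w ≡ true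
  t (inj₁ x) (inj₁ y) (inj₁ z) = ∼-trans e x y z
  t (inj₂ x) (inj₂ y) (inj₂ z) = ∼-trans f x y z

rel : {m : ℕ} → SetPartition m → Fin m → Fin m → Bool
rel P i j = lookup (lookup (table P) i) j

rel-equiv : {m : ℕ} (P : SetPartition m) → IsEquivalenceᵇ (rel P)
rel-equiv (mkPartition _ r s t) = record
  { ∼-refl  = λ i → recompute (_ ≟ᵇ true) (r i)
  ; ∼-sym   = λ i j p → recompute (_ ≟ᵇ true) (s i j p)
  ; ∼-trans = λ i j k p q → recompute (_ ≟ᵇ true) (t i j k p q)
  }

fromEquivalence : {m : ℕ} (E : Fin m → Fin m → Bool) → IsEquivalenceᵇ E → SetPartition m
fromEquivalence E e = mkPartition (tabulate λ i → tabulate (E i))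
  (λ i → trans (rel-tabulate i i) (∼-refl e i))
  (λ i j p → trans (rel-tabulate j i) (∼-sym e i j (trans (sym (rel-tabulate i j)) p)))
  (λ i j k p q → trans (rel-tabulate i k)
     (∼-trans e i j k (trans (sym (rel-tabulate i j)) p) (trans (sym (rel-tabulate j k)) q)))
  where
  rel-tabulate : ∀ i j → lookup (lookup (tabulate λ i → tabulate (E i)) i) j ≡ E i j
  rel-tabulate i j rewrite lookup∘tabulate (λ i → tabulate (E i)) i = lookup∘tabulate (E i) j

rel-fromEquivalence : {m : ℕ} (E : Fin m → Fin m → Bool) (e : IsEquivalenceᵇ E) →
                      ∀ i j → rel (fromEquivalence E e) i j ≡ E i j
rel-fromEquivalence E e i j rewrite lookup∘tabulate (λ i → tabulate (E i)) i = lookup∘tabulate (E i) j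

vec-ext : {A : Set} {k : ℕ} (v w : Vec A k) → (∀ i → lookup v i ≡ lookup w i) → v ≡ w
vec-ext v w same = trans (sym (tabulate∘lookup v)) (trans (tabulate-cong same) (tabulate∘lookup w))

partition-ext : {m : ℕ} (P Q : SetPartition m) → (∀ i j → rel P i j ≡ rel Q i j) → P ≡ Q
partition-ext (mkPartition t _ _ _) (mkPartition t′ _ _ _) same
  with vec-ext t t′ (λ i → vec-ext _ _ (same i))
... | refl = refl

anyFin : {n : ℕ} → (Fin n → Bool) → Bool
anyFin {zero}  f = false
anyFin {suc n} f = f zero ∨ anyFin (λ i → f (suc i))

anyFin-intro : {n : ℕ} (f : Fin n → Bool) (i : Fin n) → f i ≡ true → anyFin f ≡ true
anyFin-intro f zero    fi = cong (_∨ anyFin (λ i → f (suc i))) fi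
anyFin-intro f (suc i) fi = trans (cong (f zero ∨_) (anyFin-intro (λ j → f (suc j)) i fi)) (∨-zeroʳ (f zero))

anyFin-elim : {n : ℕ} (f : Fin n → Bool) → anyFin f ≡ true → Σ (Fin n) λ i → f i ≡ true
anyFin-elim {suc n} f found with f zero in f0
... | true  = zero , f0
... | false with anyFin-elim (λ j → f (suc j)) found
...   | i , fi = suc i , fi

-- [n+3] as the disjoint union of the old elements [n] and the new elements
-- n+1, n+2, n+3 (named ν₁, ν₂, ν₃), via Data.Fin's join/splitAt.
Ext : ℕ → Set
Ext n = Fin n ⊎ Fin 3

module _ {n : ℕ} where
  old : Fin n → Ext n
  old = inj₁

  ν₁ ν₂ ν₃ : Ext n
  ν₁ = inj₂ zero
  ν₂ = inj₂ (suc zero)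
  ν₃ = inj₂ (suc (suc zero))

relExt : {n : ℕ} → SetPartition (n + 3) → Ext n → Ext n → Bool
relExt {n} P u v = rel P (join n 3 u) (join n 3 v)

relExt-equiv : {n : ℕ} (P : SetPartition (n + 3)) → IsEquivalenceᵇ (relExt P)
relExt-equiv {n} P = pullback (join n 3) (rel-equiv P)

partitionOnExt : {n : ℕ} (E : Ext n → Ext n → Bool) → IsEquivalenceᵇ E → SetPartition (n + 3)
partitionOnExt {n} E e = fromEquivalence (λ i j → E (splitAt n i) (splitAt n j)) (pullback (splitAt n) e)

relExt-partitionOnExt : {n : ℕ} (E : Ext n → Ext n → Bool) (e : IsEquivalenceᵇ E) →
                        ∀ u v → relExt (partitionOnExt E e) u v ≡ E u v
relExt-partitionOnExt {n} E e u v =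
  trans (rel-fromEquivalence _ (pullback (splitAt n) e) (join n 3 u) (join n 3 v))
        (cong₂ E (splitAt-join n 3 u) (splitAt-join n 3 v))

partitionOnExt-unique : {n : ℕ} (E : Ext n → Ext n → Bool) (e : IsEquivalenceᵇ E) (P : SetPartition (n + 3)) →
                        (∀ u v → E u v ≡ relExt P u v) → partitionOnExt E e ≡ P
partitionOnExt-unique {n} E e P same = partition-ext _ P λ i j →
  trans (rel-fromEquivalence _ (pullback (splitAt n) e) i j)
        (trans (same (splitAt n i) (splitAt n j)) (cong₂ (rel P) (join-splitAt n 3 i) (join-splitAt n 3 j)))

singleton-toExt : {n : ℕ} (P : SetPartition (n + 3)) (u : Ext n) →
                  IsSingleton P (join n 3 u) → ∀ w → relExt P u w ≡ true → w ≡ u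
singleton-toExt {n} P u single w uw =
  trans (sym (splitAt-join n 3 w)) (trans (cong (splitAt n) (single (join n 3 w) uw)) (splitAt-join n 3 u))

singleton-fromExt : {n : ℕ} (P : SetPartition (n + 3)) (u : Ext n) →
                    (∀ w → relExt P u w ≡ true → w ≡ u) → IsSingleton P (join n 3 u)
singleton-fromExt {n} P u isolated j uj =
  trans (sym (join-splitAt n 3 j))
        (cong (join n 3) (isolated (splitAt n j) (subst (λ i → rel P (join n 3 u) i ≡ true) (sym (join-splitAt n 3 j)) uj)))

toℕ-ν₁ : (n : ℕ) → toℕ (join n 3 ν₁) ≡ n
toℕ-ν₁ n = trans (toℕ-↑ʳ n zero) (+-identityʳ n)

HasPartner : {n : ℕ} → (Ext n → Ext n → Bool) → Ext n → Set
HasPartner {n} E u = Σ (Ext n) λ w → E u w ≡ true × ¬ (w ≡ u)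

-- If ν₁ is a singleton and ν₂, ν₃ are not, then ν₁ = n+1 is the largest
-- singleton: every other singleton is old, hence at most n.
lspOnExt : {n : ℕ} (E : Ext n → Ext n → Bool) (e : IsEquivalenceᵇ E) →
           (∀ w → E ν₁ w ≡ true → w ≡ ν₁) → HasPartner E ν₂ → HasPartner E ν₃ →
           LargestSingletonPartition n
lspOnExt {n} E e ν₁-isolated ν₂-partner ν₃-partner =
  mkLSP P (join n 3 ν₁ , singleton-fromExt P ν₁ (onP ν₁-isolated) , toℕ-ν₁ n) largest
  where
  P : SetPartition (n + 3)
  P = partitionOnExt E e

  onP : ∀ {u} → (∀ w → E u w ≡ true → w ≡ u) → ∀ w → relExt P u w ≡ true → w ≡ u
  onP {u} isolated w uw = isolated w (trans (sym (relExt-partitionOnExt E e u w)) uw)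

  not-singleton : ∀ {u} → HasPartner E u → ¬ IsSingleton P (join n 3 u)
  not-singleton {u} (w , uw , w≢u) single =
    w≢u (singleton-toExt P u single w (trans (relExt-partitionOnExt E e u w) uw))

  bound : ∀ u → IsSingleton P (join n 3 u) → toℕ (join n 3 u) ≤ n
  bound (inj₁ x)                 _      = subst (_≤ n) (sym (toℕ-↑ˡ x 3)) (<⇒≤ (toℕ<n x))
  bound (inj₂ zero)              _      = subst (_≤ n) (sym (toℕ-ν₁ n)) ≤-refl
  bound (inj₂ (suc zero))        single = ⊥-elim (not-singleton ν₂-partner single)
  bound (inj₂ (suc (suc zero)))  single = ⊥-elim (not-singleton ν₃-partner single)

  largest : ∀ j → IsSingleton P j → toℕ j ≤ n
  largest j single = subst (λ i → toℕ i ≤ n) (join-splitAt n 3 j)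
    (bound (splitAt n j) (subst (IsSingleton P) (sym (join-splitAt n 3 j)) single))

-- Conversely, in such a partition ν₁ is a singleton ...
lsp-ν₁-isolated : {n : ℕ} (P : SetPartition (n + 3)) →
                  .(Σ (Fin (n + 3)) λ i → IsSingleton P i × toℕ i ≡ n) →
                  ∀ w → relExt P ν₁ w ≡ true → w ≡ ν₁
lsp-ν₁-isolated {n} P has w ν₁w = recompute (≡-dec _≟ᶠ_ _≟ᶠ_ w ν₁) (isolated has)
  where
  isolated : (Σ (Fin (n + 3)) λ i → IsSingleton P i × toℕ i ≡ n) → w ≡ ν₁
  isolated (i , single , i≡n) = singleton-toExt P ν₁
    (subst (IsSingleton P) (toℕ-injective (trans i≡n (sym (toℕ-ν₁ n)))) single) w ν₁w

-- ... and each of ν₂, ν₃ that is not in the block of the other one shares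
-- its block with an old element (otherwise it would be a singleton > n+1).
lsp-partner : {n : ℕ} (P : SetPartition (n + 3)) →
              (∀ w → relExt P ν₁ w ≡ true → w ≡ ν₁) → .(∀ j → IsSingleton P j → toℕ j ≤ n) →
              relExt P ν₂ ν₃ ≡ false → (k : Fin 2) → Σ (Fin n) λ x → relExt P (old x) (inj₂ (suc k)) ≡ true
lsp-partner {n} P ν₁-isolated largest ν₂≁ν₃ k
  with anyFin (λ x → relExt P (old x) (inj₂ (suc k))) in found
... | true  = anyFin-elim _ found
... | false = ⊥-elim-irr (m+1+n≰m n (subst (_≤ n) (toℕ-↑ʳ n (suc k))
                (largest _ (singleton-fromExt P (inj₂ (suc k)) (isolated k found)))))
  where
  Q-equiv : IsEquivalenceᵇ (relExt P)
  Q-equiv = relExt-equiv P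
  isolated : ∀ k → anyFin (λ x → relExt P (old x) (inj₂ (suc k))) ≡ false →
             ∀ w → relExt P (inj₂ (suc k)) w ≡ true → w ≡ inj₂ (suc k)
  isolated k none (inj₁ x) kx with
    trans (sym none) (anyFin-intro _ x (∼-sym Q-equiv (inj₂ (suc k)) (old x) kx))
  ... | ()
  isolated k _ (inj₂ zero) kw with ν₁-isolated (inj₂ (suc k)) (∼-sym Q-equiv (inj₂ (suc k)) ν₁ kw)
  ... | ()
  isolated zero       _ (inj₂ (suc zero))       _  = refl
  isolated (suc zero) _ (inj₂ (suc (suc zero))) _  = refl
  isolated zero       _ (inj₂ (suc (suc zero))) kw with trans (sym ν₂≁ν₃) kw
  ... | ()
  isolated (suc zero) _ (inj₂ (suc zero))       kw with trans (sym ν₂≁ν₃) (∼-sym Q-equiv ν₃ ν₂ kw)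
  ... | ()

isa : Colour → Bool
isa a = true
isa b = false

colourOf : Bool → Colour
colourOf true  = a
colourOf false = b

isa-colourOf : ∀ p → isa (colourOf p) ≡ p
isa-colourOf true  = refl
isa-colourOf false = refl

colourOf-isa : ∀ c → colourOf (isa c) ≡ c
colourOf-isa a = refl
colourOf-isa b = refl

isa-true : ∀ {c} → isa c ≡ true → c ≡ a
isa-true {a} _ = refl

avoiding-oneBlock : {n : ℕ} (P : SetPartition n) (col : Vec Colour n) →
                    .(¬ EqContains1a2a (mkColoured P col)) →
                    ∀ x y → isa (lookup col x) ≡ true → isa (lookup col y) ≡ true → rel P x y ≡ true
avoiding-oneBlock P col avoids x y ax ay = recompute (_ ≟ᵇ true) (oneBlock avoids)
  where
  oneBlock : ¬ EqContains1a2a (mkColoured P col) → rel P x y ≡ true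
  oneBlock avoids with rel P x y in xy | <-cmp (toℕ x) (toℕ y)
  ... | true  | _ = refl
  ... | false | tri< x<y _ _ =
    ⊥-elim (avoids (x , y , x<y , (λ same → false≢true (trans (sym xy) same)) , isa-true ax , isa-true ay))
  ... | false | tri≈ _ x≡y _ =
    trans (sym xy) (subst (λ z → rel P x z ≡ true) (toℕ-injective x≡y) (∼-refl (rel-equiv P) x))
  ... | false | tri> _ _ y<x =
    ⊥-elim (avoids (y , x , y<x , (λ same → false≢true (trans (sym xy) (∼-sym (rel-equiv P) y x same))) ,
                    isa-true ay , isa-true ax))

extend : {n : ℕ} → (Fin n → Fin n → Bool) → Ext n → Ext n → Bool
extend R = R ⊕ discrete _≟ᶠ_

extend-equiv : {n : ℕ} {R : Fin n → Fin n → Bool} → IsEquivalenceᵇ R → IsEquivalenceᵇ (extend R)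
extend-equiv R-equiv = ⊕-equiv R-equiv (discrete-equiv _≟ᶠ_)

extend-ν₁ : {n : ℕ} (R : Fin n → Fin n → Bool) (w : Ext n) → extend R ν₁ w ≡ true → w ≡ ν₁
extend-ν₁ R (inj₂ k) ν₁w = cong inj₂ (sym (discrete-sound _≟ᶠ_ ν₁w))

-- Where an old element goes, given whether it is a-coloured and whether it
-- lies in the block of the a-coloured elements.
placeOld : {n : ℕ} → Bool → Bool → Fin n → Ext n
placeOld true  _     x = ν₂
placeOld false true  x = ν₃
placeOld false false x = old x

-- Where n+3 goes, given whether that block contains a b-coloured element.
placeν₃ : {n : ℕ} → Bool → Ext n
placeν₃ true  = ν₃
placeν₃ false = ν₂

-- Nothing is placed at ν₁, so ν₁ stays a singleton.
placeOld-≢ν₁ : {n : ℕ} (p q : Bool) (x : Fin n) → ¬ (placeOld p q x ≡ ν₁)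
placeOld-≢ν₁ true  _     _ ()
placeOld-≢ν₁ false true  _ ()
placeOld-≢ν₁ false false _ ()

placeν₃-≢ν₁ : {n : ℕ} (p : Bool) → ¬ (placeν₃ {n} p ≡ ν₁)
placeν₃-≢ν₁ true  ()
placeν₃-≢ν₁ false ()

placeOld-ν₂ : {n : ℕ} (R : Fin n → Fin n → Bool) (p q : Bool) (x : Fin n) → extend R (placeOld p q x) ν₂ ≡ p
placeOld-ν₂ R true  _     _ = refl
placeOld-ν₂ R false true  _ = refl
placeOld-ν₂ R false false _ = refl

placeOld-merged : {n : ℕ} (R : Fin n → Fin n → Bool) (p q r : Bool) (x : Fin n) →
                  (p ≡ true → q ≡ true) → (p ≡ false → q ≡ true → r ≡ true) →
                  (extend R (placeOld p q x) ν₂ ∨ extend R (placeOld p q x) (placeν₃ r)) ≡ q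
placeOld-merged R true  q     r     x a→q _   = sym (a→q refl)
placeOld-merged R false true  r     x _   b→r rewrite b→r refl refl = refl
placeOld-merged R false false true  x _   _   = refl
placeOld-merged R false false false x _   _   = refl

module Forward {n : ℕ} (R : Fin n → Fin n → Bool) (R-equiv : IsEquivalenceᵇ R) (col : Vec Colour n) where

  isA : Fin n → Bool
  isA x = isa (lookup col x)

  inA-block : Fin n → Bool
  inA-block x = anyFin (λ y → isA y ∧ R x y)

  hasB : Bool
  hasB = anyFin (λ z → inA-block z ∧ not (isA z))

  -- The image partition is the pullback of extend R along relabel: the
  -- a-coloured elements join n+2, the b-coloured part of the a-block joins
  -- n+3, and n+3 joins n+2 when that part is empty.
  relabel : Ext n → Ext n
  relabel (inj₁ x)                = placeOld (isA x) (inA-block x) x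
  relabel (inj₂ (suc (suc zero))) = placeν₃ hasB
  relabel (inj₂ k)                = inj₂ k

  image : Ext n → Ext n → Bool
  image u v = extend R (relabel u) (relabel v)

  image-equiv : IsEquivalenceᵇ image
  image-equiv = pullback relabel (extend-equiv R-equiv)

  a-inA-block : ∀ x → isA x ≡ true → inA-block x ≡ true
  a-inA-block x ax = anyFin-intro _ x (trans (cong (_∧ R x x) ax) (∼-refl R-equiv x))

  inA-block-witness : ∀ x → inA-block x ≡ true → Σ (Fin n) λ y → isA y ≡ true × R x y ≡ true
  inA-block-witness x inside with anyFin-elim _ inside
  ... | y , ay∧xy = y , ∧-conicalˡ _ _ ay∧xy , ∧-conicalʳ _ _ ay∧xy

  inA-block-closed : ∀ x y → R x y ≡ true → inA-block x ≡ true → inA-block y ≡ true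
  inA-block-closed x y xy inside with inA-block-witness x inside
  ... | z , az , xz = anyFin-intro _ z (trans (cong (_∧ R y z) az) (∼-trans R-equiv y x z (∼-sym R-equiv x y xy) xz))

  hasB-intro : ∀ x → isA x ≡ false → inA-block x ≡ true → hasB ≡ true
  hasB-intro x bx inside = anyFin-intro _ x (cong₂ (λ p q → q ∧ not p) bx inside)

  crossing : ∀ x y → inA-block x ≡ true → inA-block y ≡ false → R x y ≡ false
  crossing x y inside outside with R x y in xy
  ... | false = refl
  ... | true  = trans (sym (inA-block-closed x y xy inside)) outside

  ν₁-isolated : ∀ w → image ν₁ w ≡ true → w ≡ ν₁
  ν₁-isolated w ν₁w = relabel-ν₁ w (extend-ν₁ R (relabel w) ν₁w)
    where
    relabel-ν₁ : ∀ w → relabel w ≡ ν₁ → w ≡ ν₁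
    relabel-ν₁ (inj₁ x)                eq = ⊥-elim (placeOld-≢ν₁ (isA x) (inA-block x) x eq)
    relabel-ν₁ (inj₂ zero)             _  = refl
    relabel-ν₁ (inj₂ (suc zero))       ()
    relabel-ν₁ (inj₂ (suc (suc zero))) eq = ⊥-elim (placeν₃-≢ν₁ hasB eq)

  -- With a b-coloured element in the a-block, ν₂ meets the a-coloured
  -- elements and ν₃ the b-coloured ones; otherwise ν₂ and ν₃ meet.
  ν₂-partner : HasPartner image ν₂
  ν₂-partner with hasB in bInside
  ... | false = ν₃ , cong (λ p → extend R ν₂ (placeν₃ p)) bInside , λ ()
  ... | true with anyFin-elim _ bInside
  ...   | z , z∈b with inA-block-witness z (∧-conicalˡ _ _ z∈b)
  ...     | y , ay , _ = old y , cong (λ p → extend R ν₂ (placeOld p (inA-block y) y)) ay , λ ()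

  ν₃-partner : HasPartner image ν₃
  ν₃-partner with hasB in bInside
  ... | false = ν₂ , refl , λ ()
  ... | true with anyFin-elim _ bInside
  ...   | z , z∈b = old z , cong₂ (λ p q → extend R ν₃ (placeOld p q z)) bz (∧-conicalˡ _ _ z∈b) , λ ()
    where
    bz : isA z ≡ false
    bz = not-true (∧-conicalʳ _ _ z∈b)

  result : LargestSingletonPartition n
  result = lspOnExt image image-equiv ν₁-isolated ν₂-partner ν₃-partner

  image-colour : ∀ x → image (old x) ν₂ ≡ isA x
  image-colour x = placeOld-ν₂ R (isA x) (inA-block x) x

  image-merged : ∀ x → (image (old x) ν₂ ∨ image (old x) ν₃) ≡ inA-block x
  image-merged x = placeOld-merged R (isA x) (inA-block x) hasB x (a-inA-block x) (hasB-intro x)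

  relabel-outside : ∀ x → inA-block x ≡ false → relabel (old x) ≡ old x
  relabel-outside x outside = cong₂ (λ p q → placeOld p q x) not-a outside
    where
    not-a : isA x ≡ false
    not-a with isA x in ax
    ... | true  = trans (sym (a-inA-block x ax)) outside
    ... | false = refl

  gather : Fin n → Ext n
  gather x = if inA-block x then ν₂ else old x

  gathered : (∀ x y → isA x ≡ true → isA y ≡ true → R x y ≡ true) →
             ∀ x y → image (gather x) (gather y) ≡ R x y
  gathered oneBlock x y with inA-block x in ex | inA-block y in ey
  ... | true  | true  with inA-block-witness x ex | inA-block-witness y ey
  ...   | x′ , ax′ , xx′ | y′ , ay′ , yy′ =
    sym (∼-trans R-equiv x x′ y xx′ (∼-trans R-equiv x′ y′ y (oneBlock x′ y′ ax′ ay′) (∼-sym R-equiv y y′ yy′)))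
  gathered oneBlock x y | true  | false = trans (cong (extend R ν₂) (relabel-outside y ey)) (sym (crossing x y ex ey))
  gathered oneBlock x y | false | true  =
    trans (cong (λ w → extend R w ν₂) (relabel-outside x ex)) (sym (trans (∼-comm R-equiv x y) (crossing y x ey ex)))
  gathered oneBlock x y | false | false = cong₂ (extend R) (relabel-outside x ex) (relabel-outside y ey)

module Backward {n : ℕ} (Q : Ext n → Ext n → Bool) (Q-equiv : IsEquivalenceᵇ Q) where

  colours : Vec Colour n
  colours = tabulate λ x → colourOf (Q (old x) ν₂)

  merged : Fin n → Bool
  merged x = Q (old x) ν₂ ∨ Q (old x) ν₃

  collapse : Fin n → Ext n
  collapse x = if merged x then ν₂ else old x

  restricted : Fin n → Fin n → Bool
  restricted x y = Q (collapse x) (collapse y)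

  blocks : SetPartition n
  blocks = fromEquivalence restricted (pullback collapse Q-equiv)

  rel-blocks : ∀ x y → rel blocks x y ≡ Q (collapse x) (collapse y)
  rel-blocks = rel-fromEquivalence restricted (pullback collapse Q-equiv)

  collapse-merged : ∀ x → merged x ≡ true → collapse x ≡ ν₂
  collapse-merged x m = cong (λ p → if p then ν₂ else old x) m

  collapse-apart : ∀ x → merged x ≡ false → collapse x ≡ old x
  collapse-apart x m = cong (λ p → if p then ν₂ else old x) m

  a-merged : ∀ x → Q (old x) ν₂ ≡ true → merged x ≡ true
  a-merged x xν₂ = cong (_∨ Q (old x) ν₃) xν₂

  colour-a : ∀ x → lookup colours x ≡ a → Q (old x) ν₂ ≡ true
  colour-a x xa = trans (sym (isa-colourOf _)) (cong isa (trans (sym (lookup∘tabulate _ x)) xa))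

  -- All a-coloured elements are collapsed onto ν₂, so they share a block.
  avoids : ¬ EqContains1a2a (mkColoured blocks colours)
  avoids (x , y , _ , apart , xa , ya) = apart (begin
    rel blocks x y                    ≡⟨ rel-blocks x y ⟩
    Q (collapse x) (collapse y)       ≡⟨ cong₂ Q (collapse-merged x (a-merged x (colour-a x xa)))
                                                (collapse-merged y (a-merged y (colour-a y ya))) ⟩
    Q ν₂ ν₂                           ≡⟨ ∼-refl Q-equiv ν₂ ⟩
    true                              ∎)
    where open ≡-Reasoning

  result : AvoidingColoured n
  result = mkAvoiding (mkColoured blocks colours) avoids

toLSP : {n : ℕ} → AvoidingColoured n → LargestSingletonPartition n
toLSP (mkAvoiding (mkColoured P col) _) = Forward.result (rel P) (rel-equiv P) col

fromLSP : {n : ℕ} → LargestSingletonPartition n → AvoidingColoured n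
fromLSP (mkLSP P _ _) = Backward.result (relExt P) (relExt-equiv P)

avoiding-ext : ∀ {n : ℕ} {P P′ : SetPartition n} {c c′ : Vec Colour n} .{x y} → P ≡ P′ → c ≡ c′ →
               mkAvoiding (mkColoured P c) x ≡ mkAvoiding (mkColoured P′ c′) y
avoiding-ext refl refl = refl

lsp-ext : ∀ {n : ℕ} {P P′ : SetPartition (n + 3)} .{x y x′ y′} → P ≡ P′ → mkLSP P x y ≡ mkLSP P′ x′ y′
lsp-ext refl = refl

-- Backward after forward is the identity: colours are read off at ν₂, and
-- collapsing the blocks of ν₂ and ν₃ recovers the a-block.
from∘to : {n : ℕ} (A : AvoidingColoured n) → fromLSP (toLSP A) ≡ A
from∘to {n} (mkAvoiding (mkColoured P col) avoids) = avoiding-ext same-blocks same-colours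
  where
  open Forward (rel P) (rel-equiv P) col
  Q : Ext n → Ext n → Bool
  Q = relExt (partitionOnExt image image-equiv)
  module B = Backward Q (relExt-equiv (partitionOnExt image image-equiv))
  open ≡-Reasoning

  Q≡image : ∀ u v → Q u v ≡ image u v
  Q≡image = relExt-partitionOnExt image image-equiv

  same-colours : B.colours ≡ col
  same-colours = vec-ext _ _ λ x → begin
    lookup B.colours x         ≡⟨ lookup∘tabulate _ x ⟩
    colourOf (Q (old x) ν₂)    ≡⟨ cong colourOf (trans (Q≡image (old x) ν₂) (image-colour x)) ⟩
    colourOf (isA x)           ≡⟨ colourOf-isa (lookup col x) ⟩
    lookup col x               ∎

  collapse≡gather : ∀ x → B.collapse x ≡ gather x
  collapse≡gather x = cong (λ p → if p then ν₂ else old x)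
    (trans (cong₂ _∨_ (Q≡image (old x) ν₂) (Q≡image (old x) ν₃)) (image-merged x))

  same-blocks : B.blocks ≡ P
  same-blocks = partition-ext _ P λ x y → begin
    rel B.blocks x y                    ≡⟨ B.rel-blocks x y ⟩
    Q (B.collapse x) (B.collapse y)     ≡⟨ Q≡image (B.collapse x) (B.collapse y) ⟩
    image (B.collapse x) (B.collapse y) ≡⟨ cong₂ image (collapse≡gather x) (collapse≡gather y) ⟩
    image (gather x) (gather y)         ≡⟨ gathered (avoiding-oneBlock P col avoids) x y ⟩
    rel P x y                           ∎

module BackwardThenForward {n : ℕ} (Q : Ext n → Ext n → Bool) (Q-equiv : IsEquivalenceᵇ Q)
  (ν₁-isolated : ∀ w → Q ν₁ w ≡ true → w ≡ ν₁)
  (partner : Q ν₂ ν₃ ≡ false → (k : Fin 2) → Σ (Fin n) λ x → Q (old x) (inj₂ (suc k)) ≡ true) where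

  open Backward Q Q-equiv
  module F = Forward (rel blocks) (rel-equiv blocks) colours

  ν₁-apart : ∀ u → ¬ (u ≡ ν₁) → Q ν₁ u ≡ false
  ν₁-apart u u≢ν₁ with Q ν₁ u in ν₁u
  ... | false = refl
  ... | true  = ⊥-elim (u≢ν₁ (ν₁-isolated u ν₁u))

  separates : ∀ x → Q (old x) ν₂ ≡ false → Q (old x) ν₃ ≡ true → Q ν₂ ν₃ ≡ false
  separates x xν₂ xν₃ with Q ν₂ ν₃ in ν₂ν₃
  ... | false = refl
  ... | true  = trans (sym (∼-trans Q-equiv (old x) ν₃ ν₂ xν₃ (∼-sym Q-equiv ν₂ ν₃ ν₂ν₃))) xν₂

  ν₃-not-ν₂ : ∀ x → Q ν₂ ν₃ ≡ false → Q (old x) ν₃ ≡ true → Q (old x) ν₂ ≡ false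
  ν₃-not-ν₂ x ν₂≁ν₃ xν₃ with Q (old x) ν₂ in xν₂
  ... | false = refl
  ... | true  = trans (sym (∼-trans Q-equiv ν₂ (old x) ν₃ (∼-sym Q-equiv (old x) ν₂ xν₂) xν₃)) ν₂≁ν₃

  merged-ν₃ : ∀ x → Q (old x) ν₂ ≡ false → merged x ≡ true → Q (old x) ν₃ ≡ true
  merged-ν₃ x xν₂ m = trans (sym (cong (_∨ Q (old x) ν₃) xν₂)) m

  collapse-ν₂ : ∀ x → Q (collapse x) ν₂ ≡ merged x
  collapse-ν₂ x with merged x in m
  ... | true  = ∼-refl Q-equiv ν₂
  ... | false = ∨-conicalˡ _ _ m

  a-coloured-exists : ∀ x → merged x ≡ true → Σ (Fin n) λ y → Q (old y) ν₂ ≡ true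
  a-coloured-exists x m with Q (old x) ν₂ in xν₂
  ... | true  = x , xν₂
  ... | false = partner (separates x xν₂ m) zero

  isA≡ : ∀ x → F.isA x ≡ Q (old x) ν₂
  isA≡ x = trans (cong isa (lookup∘tabulate _ x)) (isa-colourOf _)

  inA-block≡ : ∀ x → F.inA-block x ≡ merged x
  inA-block≡ x = bool-ext to from
    where
    to : F.inA-block x ≡ true → merged x ≡ true
    to inside with F.inA-block-witness x inside
    ... | y , ay , xy = begin
      merged x                     ≡⟨ collapse-ν₂ x ⟨
      Q (collapse x) ν₂            ≡⟨ cong (Q (collapse x)) (collapse-merged y (a-merged y (trans (sym (isA≡ y)) ay))) ⟨
      Q (collapse x) (collapse y)  ≡⟨ rel-blocks x y ⟨
      rel blocks x y               ≡⟨ xy ⟩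
      true                         ∎
      where open ≡-Reasoning
    from : merged x ≡ true → F.inA-block x ≡ true
    from m with a-coloured-exists x m
    ... | y , yν₂ = anyFin-intro _ y (cong₂ _∧_ (trans (isA≡ y) yν₂)
      (trans (rel-blocks x y) (trans (cong₂ Q (collapse-merged x m) (collapse-merged y (a-merged y yν₂)))
                                     (∼-refl Q-equiv ν₂))))

  hasB≡ : F.hasB ≡ not (Q ν₂ ν₃)
  hasB≡ = bool-ext to from
    where
    to : F.hasB ≡ true → not (Q ν₂ ν₃) ≡ true
    to found with anyFin-elim _ found
    ... | z , z∈b = cong not (separates z zν₂ (merged-ν₃ z zν₂ (trans (sym (inA-block≡ z)) (∧-conicalˡ _ _ z∈b))))
      where
      zν₂ : Q (old z) ν₂ ≡ false
      zν₂ = not-true (trans (cong not (sym (isA≡ z))) (∧-conicalʳ _ _ z∈b))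
    from : not (Q ν₂ ν₃) ≡ true → F.hasB ≡ true
    from notν₂ν₃ with partner (not-true notν₂ν₃) (suc zero)
    ... | z , zν₃ = anyFin-intro _ z (cong₂ _∧_
      (trans (inA-block≡ z) (trans (cong (Q (old z) ν₂ ∨_) zν₃) (∨-zeroʳ _)))
      (cong not (trans (isA≡ z) (ν₃-not-ν₂ z (not-true notν₂ν₃) zν₃))))

  -- Points that may occur as F.relabel u, on which extend (rel blocks) and Q agree.
  data Representative : Ext n → Set where
    rep-old : ∀ x → merged x ≡ false → Representative (old x)
    rep-ν₁  : Representative ν₁
    rep-ν₂  : Representative ν₂
    rep-ν₃  : Q ν₂ ν₃ ≡ false → Representative ν₃

  InClass : Ext n → Ext n → Set
  InClass u w = Representative w × Q u w ≡ true

  placeOld-rep : ∀ x p q → Q (old x) ν₂ ≡ p → merged x ≡ q → InClass (old x) (placeOld p q x)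
  placeOld-rep x true  _     xν₂ _ = rep-ν₂ , xν₂
  placeOld-rep x false true  xν₂ m = rep-ν₃ (separates x xν₂ (merged-ν₃ x xν₂ m)) , merged-ν₃ x xν₂ m
  placeOld-rep x false false _   m = rep-old x m , ∼-refl Q-equiv (old x)

  placeν₃-rep : ∀ p → Q ν₂ ν₃ ≡ p → InClass ν₃ (placeν₃ (not p))
  placeν₃-rep true  ν₂ν₃  = rep-ν₂ , ∼-sym Q-equiv ν₂ ν₃ ν₂ν₃
  placeν₃-rep false ν₂≁ν₃ = rep-ν₃ ν₂≁ν₃ , ∼-refl Q-equiv ν₃

  relabel-rep : ∀ u → InClass u (F.relabel u)
  relabel-rep (inj₁ x) = subst (InClass (old x)) (sym (cong₂ (λ p q → placeOld p q x) (isA≡ x) (inA-block≡ x)))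
                           (placeOld-rep x _ _ refl refl)
  relabel-rep (inj₂ zero)             = rep-ν₁ , ∼-refl Q-equiv ν₁
  relabel-rep (inj₂ (suc zero))       = rep-ν₂ , ∼-refl Q-equiv ν₂
  relabel-rep (inj₂ (suc (suc zero))) = subst (InClass ν₃) (sym (cong placeν₃ hasB≡)) (placeν₃-rep _ refl)

  agree-old : ∀ x {w} → merged x ≡ false → Representative w → extend (rel blocks) (old x) w ≡ Q (old x) w
  agree-old x mx (rep-old y my) = trans (rel-blocks x y) (cong₂ Q (collapse-apart x mx) (collapse-apart y my))
  agree-old x mx rep-ν₁         = sym (trans (∼-comm Q-equiv (old x) ν₁) (ν₁-apart (old x) λ ()))
  agree-old x mx rep-ν₂         = sym (∨-conicalˡ _ _ mx)
  agree-old x mx (rep-ν₃ _)     = sym (∨-conicalʳ _ _ mx)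

  agree : ∀ {w w′} → Representative w → Representative w′ → extend (rel blocks) w w′ ≡ Q w w′
  agree (rep-old x mx) r′ = agree-old x mx r′
  agree {w} r (rep-old y my) =
    trans (∼-comm (extend-equiv (rel-equiv blocks)) w (old y)) (trans (agree-old y my r) (∼-comm Q-equiv (old y) w))
  agree rep-ν₁     rep-ν₁     = sym (∼-refl Q-equiv ν₁)
  agree rep-ν₁     rep-ν₂     = sym (ν₁-apart ν₂ λ ())
  agree rep-ν₁     (rep-ν₃ _) = sym (ν₁-apart ν₃ λ ())
  agree rep-ν₂     rep-ν₁     = sym (trans (∼-comm Q-equiv ν₂ ν₁) (ν₁-apart ν₂ λ ()))
  agree rep-ν₂     rep-ν₂     = sym (∼-refl Q-equiv ν₂)
  agree rep-ν₂     (rep-ν₃ s) = sym s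
  agree (rep-ν₃ _) rep-ν₁     = sym (trans (∼-comm Q-equiv ν₃ ν₁) (ν₁-apart ν₃ λ ()))
  agree (rep-ν₃ s) rep-ν₂     = sym (trans (∼-comm Q-equiv ν₃ ν₂) s)
  agree (rep-ν₃ _) (rep-ν₃ _) = sym (∼-refl Q-equiv ν₃)

  image≡ : ∀ u v → F.image u v ≡ Q u v
  image≡ = pullback-of-representatives {E = extend (rel blocks)} Q-equiv F.relabel (λ u → proj₂ (relabel-rep u))
    (λ u v → agree (proj₁ (relabel-rep u)) (proj₁ (relabel-rep v)))

to∘from : {n : ℕ} (L : LargestSingletonPartition n) → toLSP (fromLSP L) ≡ L
to∘from (mkLSP P has largest) = lsp-ext (partitionOnExt-unique BF.F.image BF.F.image-equiv P BF.image≡)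
  where
  ν₁-isolated : ∀ w → relExt P ν₁ w ≡ true → w ≡ ν₁
  ν₁-isolated = lsp-ν₁-isolated P has
  module BF = BackwardThenForward (relExt P) (relExt-equiv P) ν₁-isolated (lsp-partner P ν₁-isolated largest)

theorem3p1 : (n : ℕ) → 1 ≤ n → AvoidingColoured n ⤖ LargestSingletonPartition n
theorem3p1 n _ = ↔⇒⤖ (mk↔ₛ′ toLSP fromLSP to∘from from∘to)
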